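{- Let $G$ be a simple graph on $21$ vertices that contains no clique on $5$ vertices and no independent set of $5$ vertices, and suppose $G$ has two non-adjacent vertices each of degree at most $4$. Then either $G$ contains a vertex of degree at least $8$, or $G$ contains a clique on $4$ vertices $\{w_1,w_2,w_3,w_4\}$ with $\deg_G(w_1)+\deg_G(w_2)+\deg_G(w_3)+\deg_G(w_4) \leq 24$.
   Context: A Ramsey graph of type $(s,t)$ is a simple graph with no clique of size $s$ and no independent set of size $t$; $\mathcal{R}(s,t,n)$ denotes the set of such graphs on $n$ vertices. The hypothesis says $G \in \mathcal{R}(5,5,21)$. -}

module Defs where

open import Data.Nat using (ℕ; _+_; _≤_)
open import Data.Bool using (Bool; true; false; T)
open import Data.Fin using (Fin)
open import Data.List using (List; length; filter)
open import Data.List.Base using (allFin)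
open import Data.Product using (Σ; _×_; ∃-syntax)
open import Relation.Binary.PropositionalEquality using (_≡_; _≢_)
open import Relation.Nullary using (¬_)
open import Relation.Nullary.Decidable using (Dec)
open import Data.Bool.Properties using (T?)

record SimpleGraph (n : ℕ) : Set where
  field
    adj     : Fin n → Fin n → Bool
    sym     : ∀ i j → adj i j ≡ adj j i
    irrefl  : ∀ i → adj i i ≡ false
open SimpleGraph public

Adj : ∀ {n} → SimpleGraph n → Fin n → Fin n → Set
Adj G i j = T (adj G i j)

degree : ∀ {n} → SimpleGraph n → Fin n → ℕ
degree {n} G v = length (filter (λ w → T? (adj G v w)) (allFin n))

IsClique : ∀ {n k} → SimpleGraph n → (Fin k → Fin n) → Set
IsClique G f = ∀ i j → i ≢ j → Adj G (f i) (f j)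

IsIndependent : ∀ {n k} → SimpleGraph n → (Fin k → Fin n) → Set
IsIndependent G f = ∀ i j → i ≢ j → (f i ≢ f j) × ¬ Adj G (f i) (f j)

HasClique : ∀ {n} → SimpleGraph n → ℕ → Set
HasClique G k = Σ (Fin k → _) λ f → IsClique G f

HasIndependentSet : ∀ {n} → SimpleGraph n → ℕ → Set
HasIndependentSet G k = Σ (Fin k → _) λ f → IsIndependent G f

IsRamsey : ℕ → ℕ → ∀ {n} → SimpleGraph n → Set
IsRamsey s t G = ¬ HasClique G s × ¬ HasIndependentSet G t

module Submission where

-- Assume Δ(G) ≤ 7 and let W be the set of vertices outside N[u] ∪ N[v], so |W| ≥ 21 − 10 = 11.
-- For x ∈ W the vertices of W outside N[x] form a clique (with u, v, x they would otherwise
-- contain an independent 5-set), so there are at most 4 of them; hence x has at least |W| − 5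
-- neighbours in W, so |W| ≤ 12 and x has at most 12 − |W| ≤ 1 neighbours outside W.
-- Let A = N(u) ∖ N(v) and B = N(v) ∖ N(u). If A and B both contain a nonadjacent pair, the
-- vertices of W missing both members of either pair again form cliques, so some x ∈ W is adjacent
-- to a vertex of A and a vertex of B: two neighbours outside W, which is impossible. So w.l.o.g.
-- A is a clique; then A ∪ {u} is too, so |A| ≤ 3, and counting gives |A| = 3 and |W| = 12, so no
-- edge leaves W. The 4-clique {u} ∪ A has degree sum at most 4 + 3·7 = 25. If u and v have no
-- common neighbour then deg u = 3. Otherwise a common neighbour c misses some a ∈ A (or
-- {c, u} ∪ A would be a 5-clique), and all neighbours of a lie among the 9 vertices outside W
-- other than v, c and a, so deg a ≤ 6.

open import Defs hiding (sym)
open import Data.Bool using (T)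
open import Data.Bool.Properties using (T?)
open import Data.Empty using (⊥; ⊥-elim)
open import Data.Fin using (Fin; zero; suc; _≟_)
open import Data.Fin.Properties using (any?; all?; ¬∀⟶∃¬)
open import Data.List using (List; []; _∷_; length; filter; allFin)
open import Data.List.Membership.Propositional using (lose)
open import Data.List.Membership.Propositional.Properties using (∈-allFin)
open import Data.List.Properties using (filter-some; length-tabulate)
open import Data.List.Relation.Unary.All as All using (All; []; _∷_)
open import Data.List.Relation.Unary.All.Properties using (all-filter)
open import Data.List.Relation.Unary.Unique.Propositional using (Unique; []; _∷_)
open import Data.List.Relation.Unary.Unique.Propositional.Properties using (allFin⁺)
  renaming (filter⁺ to unique-filter)
open import Data.Nat using (ℕ; zero; suc; _+_; _≤_; z≤n; s≤s; _≤?_)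
open import Data.Nat.Properties
  using ( ≤-trans; ≤-reflexive; ≤-pred; <-irrefl; ≰⇒>; ≮⇒≥; m≤n⇒m≤1+n; m≤m+n; +-suc; +-comm; +-assoc
        ; +-mono-≤; +-monoˡ-≤; +-monoʳ-≤; +-cancelˡ-≤; +-cancelʳ-≤; module ≤-Reasoning )
open import Data.Product using (Σ; _×_; _,_; ∃; ∃-syntax; proj₁; proj₂)
open import Data.Sum using (_⊎_; inj₁; inj₂; [_,_]′; map₂)
open import Data.Vec.Functional using (Vector) renaming ([] to []ᵛ; _∷_ to _∷ᵛ_)
open import Function using (_∘_; case_of_; _$_)
open import Function.Definitions using (Injective)
open import Level using (0ℓ)
open import Relation.Binary.PropositionalEquality
  using (_≡_; _≢_; refl; sym; trans; cong; subst; ≢-sym)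
open import Relation.Nullary using (¬_; yes; no; ¬?; Dec)
open import Relation.Nullary.Decidable using (_×-dec_; decidable-stable)
open import Relation.Unary using (Pred; Decidable; _∈_; _∉_; _⊆_; _∩_; _∪_; _∖_; ∁; ｛_｝)
open import Relation.Unary.Properties using (_∩?_; _∪?_; ∁?)

module _ {A : Set} {P Q : Pred A 0ℓ} (P? : Decidable P) (Q? : Decidable Q) where

  filter-mono : P ⊆ Q → ∀ xs → length (filter P? xs) ≤ length (filter Q? xs)
  filter-mono P⊆Q [] = z≤n
  filter-mono P⊆Q (x ∷ xs) with P? x | Q? x
  ... | yes _ | yes _  = s≤s (filter-mono P⊆Q xs)
  ... | yes p | no ¬q  = ⊥-elim (¬q (P⊆Q p))
  ... | no _  | yes _  = m≤n⇒m≤1+n (filter-mono P⊆Q xs)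
  ... | no _  | no _   = filter-mono P⊆Q xs

  length-filter-split : ∀ xs → length (filter P? xs) ≡
                        length (filter (P? ∩? Q?) xs) + length (filter (P? ∩? ∁? Q?) xs)
  length-filter-split [] = refl
  length-filter-split (x ∷ xs) with P? x | Q? x
  ... | yes _ | yes _ = cong suc (length-filter-split xs)
  ... | yes _ | no _  = trans (cong suc (length-filter-split xs)) (sym (+-suc _ _))
  ... | no _  | _     = length-filter-split xs

module _ {A : Set} {P : Pred A 0ℓ} (P? : Decidable P) where

  length-filter-∁ : ∀ xs → length (filter P? xs) + length (filter (∁? P?) xs) ≡ length xs
  length-filter-∁ [] = refl
  length-filter-∁ (x ∷ xs) with P? x
  ... | yes _ = cong suc (length-filter-∁ xs)
  ... | no _  = trans (+-suc _ _) (cong suc (length-filter-∁ xs))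

injective-family : ∀ {A : Set} {k} {Q : A → Set} {xs : List A} →
                   Unique xs → All Q xs → k ≤ length xs →
                   Σ (Vector A k) λ f → Injective _≡_ _≡_ f × (∀ i → Q (f i))
injective-family {k = zero} _ _ _ = []ᵛ , (λ { {()} }) , λ ()
injective-family {k = suc k} {Q} {x ∷ xs} (x≢xs ∷ unique) (qx ∷ qxs) (s≤s k≤) =
  x ∷ᵛ g , x∷g-injective , x∷g∈Q
  where
  rest = injective-family {Q = λ y → x ≢ y × Q y} unique (All.zip (x≢xs , qxs)) k≤
  g = proj₁ rest
  g-injective = proj₁ (proj₂ rest)
  g∈ = proj₂ (proj₂ rest)
  x∷g-injective : Injective _≡_ _≡_ (x ∷ᵛ g)
  x∷g-injective {zero}  {zero}  _ = refl
  x∷g-injective {zero}  {suc j} e = ⊥-elim (proj₁ (g∈ j) e)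
  x∷g-injective {suc i} {zero}  e = ⊥-elim (proj₁ (g∈ i) (sym e))
  x∷g-injective {suc i} {suc j} e = cong suc (g-injective e)
  x∷g∈Q : ∀ i → Q ((x ∷ᵛ g) i)
  x∷g∈Q zero    = qx
  x∷g∈Q (suc i) = proj₂ (g∈ i)

module _ {n : ℕ} where

  -- Opaque, so that the decider inside ∣ P? ∣ can be recovered by unification and counts over
  -- Fin 21 are never unfolded.
  opaque
    ∣_∣ : {P : Pred (Fin n) 0ℓ} → Decidable P → ℕ
    ∣ P? ∣ = length (filter P? (allFin n))

  _∖?_ : {P Q : Pred (Fin n) 0ℓ} → Decidable P → Decidable Q → Decidable (P ∖ Q)
  P? ∖? Q? = P? ∩? ∁? Q?

  ｛_｝? : (y : Fin n) → Decidable ｛ y ｝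
  ｛ y ｝? = y ≟_

  opaque
    unfolding ∣_∣

    ∣∣-mono : {P Q : Pred (Fin n) 0ℓ} {P? : Decidable P} {Q? : Decidable Q} →
              P ⊆ Q → ∣ P? ∣ ≤ ∣ Q? ∣
    ∣∣-mono {P? = P?} {Q?} P⊆Q = filter-mono P? Q? P⊆Q (allFin n)

    ∣∣-split : {P Q : Pred (Fin n) 0ℓ} {P? : Decidable P} {Q? : Decidable Q} →
               ∣ P? ∣ ≡ ∣ P? ∩? Q? ∣ + ∣ P? ∖? Q? ∣
    ∣∣-split {P? = P?} {Q?} = length-filter-split P? Q? (allFin n)

    ∣∣-∁ : {P : Pred (Fin n) 0ℓ} (P? : Decidable P) → ∣ P? ∣ + ∣ ∁? P? ∣ ≡ n
    ∣∣-∁ P? = trans (length-filter-∁ P? (allFin n)) (length-tabulate _)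

    ∈⇒∣∣≥1 : {P : Pred (Fin n) 0ℓ} {P? : Decidable P} {x : Fin n} → x ∈ P → 1 ≤ ∣ P? ∣
    ∈⇒∣∣≥1 {P? = P?} {x} x∈P = filter-some P? (lose (∈-allFin x) x∈P)

    choose : ∀ {k} {P : Pred (Fin n) 0ℓ} {P? : Decidable P} → k ≤ ∣ P? ∣ →
             Σ (Vector (Fin n) k) λ f → Injective _≡_ _≡_ f × (∀ i → f i ∈ P)
    choose {P? = P?} = injective-family (unique-filter P? (allFin⁺ n)) (all-filter P? (allFin n))

  ∣∪∣≤∣∣+∣∖∣ : {P Q : Pred (Fin n) 0ℓ} {P? : Decidable P} {Q? : Decidable Q} →
         ∣ P? ∪? Q? ∣ ≤ ∣ P? ∣ + ∣ Q? ∖? P? ∣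
  ∣∪∣≤∣∣+∣∖∣ {P} {Q} {P?} {Q?} = begin
    ∣ P? ∪? Q? ∣                              ≡⟨ ∣∣-split ⟩
    ∣ (P? ∪? Q?) ∩? P? ∣ + ∣ (P? ∪? Q?) ∖? P? ∣ ≤⟨ +-mono-≤ (∣∣-mono proj₂) (∣∣-mono Q∖P) ⟩
    ∣ P? ∣ + ∣ Q? ∖? P? ∣                     ∎
    where
    open ≤-Reasoning
    Q∖P : (P ∪ Q) ∖ P ⊆ Q ∖ P
    Q∖P (inj₁ p , ¬p) = ⊥-elim (¬p p)
    Q∖P (inj₂ q , ¬p) = q , ¬p

  ∣∪∣≤∣∣+∣∣ : {P Q : Pred (Fin n) 0ℓ} {P? : Decidable P} {Q? : Decidable Q} →
              ∣ P? ∪? Q? ∣ ≤ ∣ P? ∣ + ∣ Q? ∣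
  ∣∪∣≤∣∣+∣∣ {P? = P?} = ≤-trans ∣∪∣≤∣∣+∣∖∣ (+-monoʳ-≤ ∣ P? ∣ (∣∣-mono proj₁))

  ∣∣≥1⇒∈ : {P : Pred (Fin n) 0ℓ} {P? : Decidable P} → 1 ≤ ∣ P? ∣ → ∃ (_∈ P)
  ∣∣≥1⇒∈ h = let f , _ , f∈P = choose h in f zero , f∈P zero

  ∣｛｝∣≤1 : ∀ y → ∣ ｛ y ｝? ∣ ≤ 1
  ∣｛｝∣≤1 y = ≮⇒≥ λ 1<∣y∣ →
    let f , f-injective , f∈｛y｝ = choose 1<∣y∣
    in case f-injective (trans (sym (f∈｛y｝ zero)) (f∈｛y｝ (suc zero))) of λ ()

  length≤∣∣ : {P : Pred (Fin n) 0ℓ} {P? : Decidable P} {xs : List (Fin n)} →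
              Unique xs → All (_∈ P) xs → length xs ≤ ∣ P? ∣
  length≤∣∣ [] [] = z≤n
  length≤∣∣ {P} {P?} {x ∷ xs} (x≢xs ∷ unique) (x∈P ∷ xs∈P) = begin
    1 + length xs
      ≤⟨ +-mono-≤ (∈⇒∣∣≥1 (x∈P , refl)) (length≤∣∣ unique xs∈P∖x) ⟩
    ∣ P? ∩? ｛ x ｝? ∣ + ∣ P? ∖? ｛ x ｝? ∣ ≡⟨ sym ∣∣-split ⟩
    ∣ P? ∣                                 ∎
    where
    open ≤-Reasoning
    xs∈P∖x : All (_∈ P ∖ ｛ x ｝) xs
    xs∈P∖x = All.zipWith (λ (x≢y , y∈P) → y∈P , x≢y) (x≢xs , xs∈P)

module _ {n : ℕ} (G : SimpleGraph n) where

  Nonadjacent : Fin n → Fin n → Set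
  Nonadjacent x y = x ≢ y × ¬ Adj G x y

  N? : (x : Fin n) → Decidable (Adj G x)
  N? x y = T? (adj G x y)

  opaque
    unfolding ∣_∣

    degree≡∣N∣ : ∀ x → degree G x ≡ ∣ N? x ∣
    degree≡∣N∣ x = refl

  adj-sym : ∀ {x y} → Adj G x y → Adj G y x
  adj-sym {x} {y} = subst T (SimpleGraph.sym G x y)

  adj⇒≢ : ∀ {x y} → Adj G x y → x ≢ y
  adj⇒≢ {x} x~x refl = subst T (irrefl G x) x~x

  adj-≢ : ∀ {x y z} → Adj G x y → ¬ Adj G x z → y ≢ z
  adj-≢ x~y x≁z refl = x≁z x~y

  ∉N[x]⇒nonadjacent : ∀ {x y} → y ∉ Adj G x ∪ ｛ x ｝ → Nonadjacent y x
  ∉N[x]⇒nonadjacent y∉N[x] = (λ y≡x → y∉N[x] (inj₂ (sym y≡x))) , λ y~x → y∉N[x] (inj₁ (adj-sym y~x))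

  nonadjacent-sym : ∀ {x y} → Nonadjacent x y → Nonadjacent y x
  nonadjacent-sym (x≢y , x≁y) = x≢y ∘ sym , x≁y ∘ adj-sym

  clique-∷ : ∀ {k x} {f : Vector (Fin n) k} → IsClique G f → (∀ i → Adj G x (f i)) →
             IsClique G (x ∷ᵛ f)
  clique-∷ f-clique x~f zero    zero    0≢0 = ⊥-elim (0≢0 refl)
  clique-∷ f-clique x~f zero    (suc j) _   = x~f j
  clique-∷ f-clique x~f (suc i) zero    _   = adj-sym (x~f i)
  clique-∷ f-clique x~f (suc i) (suc j) i≢j = f-clique i j (i≢j ∘ cong suc)

  independent-∷ : ∀ {k x} {f : Vector (Fin n) k} → IsIndependent G f →
                  (∀ i → Nonadjacent x (f i)) → IsIndependent G (x ∷ᵛ f)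
  independent-∷ f-independent x≁f zero    zero    0≢0 = ⊥-elim (0≢0 refl)
  independent-∷ f-independent x≁f zero    (suc j) _   = x≁f j
  independent-∷ f-independent x≁f (suc i) zero    _   = nonadjacent-sym (x≁f i)
  independent-∷ f-independent x≁f (suc i) (suc j) i≢j = f-independent i j (i≢j ∘ cong suc)

  independent₃ : ∀ {x y z} → Nonadjacent x y → Nonadjacent x z → Nonadjacent y z →
                 IsIndependent G (x ∷ᵛ y ∷ᵛ z ∷ᵛ []ᵛ)
  independent₃ x≁y x≁z y≁z =
    independent-∷ (independent-∷ (independent-∷ (λ ()) (λ ())) λ { zero → y≁z ; (suc ()) })
                  λ { zero → x≁y ; (suc zero) → x≁z ; (suc (suc ())) }

  PairwiseAdjacent : Pred (Fin n) 0ℓ → Set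
  PairwiseAdjacent P = ∀ {y z} → y ∈ P → z ∈ P → y ≢ z → Adj G y z

  NonadjacentPairIn : Pred (Fin n) 0ℓ → Set
  NonadjacentPairIn P = ∃ λ p → ∃ λ q → p ∈ P × q ∈ P × Nonadjacent p q

  module _ {P : Pred (Fin n) 0ℓ} {P? : Decidable P} (P-pairwiseAdjacent : PairwiseAdjacent P) where

    pairwiseAdjacent⇒clique : ∀ {k} → k ≤ ∣ P? ∣ →
                              Σ (Vector (Fin n) k) λ f → IsClique G f × (∀ i → f i ∈ P)
    pairwiseAdjacent⇒clique k≤∣P∣ =
      let f , f-injective , f∈P = choose k≤∣P∣
      in f , (λ i j i≢j → P-pairwiseAdjacent (f∈P i) (f∈P j) (i≢j ∘ f-injective)) , f∈P

    ∣pairwiseAdjacent∣≤ : ∀ {k} → ¬ HasClique G (suc k) → ∣ P? ∣ ≤ k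
    ∣pairwiseAdjacent∣≤ noClique = ≮⇒≥ λ k<∣P∣ →
      let f , f-clique , _ = pairwiseAdjacent⇒clique k<∣P∣ in noClique (f , f-clique)

    ∣pairwiseAdjacent-neighbours∣≤ : ∀ {k x} → ¬ HasClique G (2 + k) → P ⊆ Adj G x → ∣ P? ∣ ≤ k
    ∣pairwiseAdjacent-neighbours∣≤ {x = x} noClique P⊆N = ≮⇒≥ λ k<∣P∣ →
      let f , f-clique , f∈P = pairwiseAdjacent⇒clique k<∣P∣
      in noClique (x ∷ᵛ f , clique-∷ f-clique (P⊆N ∘ f∈P))

  commonNonNeighbours-pairwiseAdjacent :
    ∀ {k} {f : Vector (Fin n) k} {P : Pred (Fin n) 0ℓ} → ¬ HasIndependentSet G (2 + k) →
    IsIndependent G f → (∀ {y} → y ∈ P → ∀ i → Nonadjacent y (f i)) → PairwiseAdjacent P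
  commonNonNeighbours-pairwiseAdjacent {f = f} noIndependent f-independent P≁f {y} {z} y∈P z∈P y≢z =
    decidable-stable (N? y z) λ y≁z →
      noIndependent (y ∷ᵛ z ∷ᵛ f , independent-∷ (independent-∷ f-independent (P≁f z∈P))
                                                λ { zero → y≢z , y≁z ; (suc i) → P≁f y∈P i })

  pairwiseAdjacent-or-nonadjacentPair : {P : Pred (Fin n) 0ℓ} → Decidable P →
                                        PairwiseAdjacent P ⊎ NonadjacentPairIn P
  pairwiseAdjacent-or-nonadjacentPair P?
    with any? (λ p → any? (λ q → P? p ×-dec P? q ×-dec ¬? (p ≟ q) ×-dec ¬? (N? p q)))
  ... | yes (p , q , pair) = inj₂ (p , q , pair)
  ... | no noPair = inj₁ λ {y} {z} y∈P z∈P y≢z →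
          decidable-stable (N? y z) λ y≁z → noPair (y , z , y∈P , z∈P , y≢z , y≁z)

  nonNeighbours-of-pair-pairwiseAdjacent :
    ¬ HasIndependentSet G 5 → ∀ {x y p q} {S : Pred (Fin n) 0ℓ} → ¬ Adj G x y →
    p ∈ Adj G x ∖ Adj G y → q ∈ Adj G x ∖ Adj G y → Nonadjacent p q →
    (∀ {s} → s ∈ S → Nonadjacent s x × Nonadjacent s y) → PairwiseAdjacent (S ∖ (Adj G p ∪ Adj G q))
  nonNeighbours-of-pair-pairwiseAdjacent noIndependent {x} {y} {p} {q} {S}
                                         x≁y (x~p , y≁p) (x~q , y≁q) p≁q S-far =
    commonNonNeighbours-pairwiseAdjacent noIndependent
      (independent₃ (y≢ x~p , y≁p) (y≢ x~q , y≁q) p≁q) s≁ypq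
    where
    y≢ : ∀ {r} → Adj G x r → y ≢ r
    y≢ x~r = adj-≢ x~r x≁y ∘ sym
    ≢-of-N[x] : ∀ {r s} → Adj G x r → s ∈ S → s ≢ r
    ≢-of-N[x] x~r s∈S = adj-≢ x~r (proj₂ (proj₁ (S-far s∈S)) ∘ adj-sym) ∘ sym
    s≁ypq : ∀ {s} → s ∈ S ∖ (Adj G p ∪ Adj G q) → ∀ i → Nonadjacent s ((y ∷ᵛ p ∷ᵛ q ∷ᵛ []ᵛ) i)
    s≁ypq (s∈S , _)     zero                = proj₂ (S-far s∈S)
    s≁ypq (s∈S , s∉Npq) (suc zero)          = ≢-of-N[x] x~p s∈S , s∉Npq ∘ inj₁ ∘ adj-sym
    s≁ypq (s∈S , s∉Npq) (suc (suc zero))    = ≢-of-N[x] x~q s∈S , s∉Npq ∘ inj₂ ∘ adj-sym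

  neighbour-of-pair : ∀ {P : Pred (Fin n) 0ℓ} {p q x} → p ∈ P → q ∈ P → x ∈ Adj G p ∪ Adj G q →
                      ∃ λ r → r ∈ P × Adj G x r
  neighbour-of-pair p∈P q∈P (inj₁ p~x) = _ , p∈P , adj-sym p~x
  neighbour-of-pair p∈P q∈P (inj₂ q~x) = _ , q∈P , adj-sym q~x

  degreeSum : Vector (Fin n) 4 → ℕ
  degreeSum w = degree G (w zero) + degree G (w (suc zero)) + degree G (w (suc (suc zero)))
                + degree G (w (suc (suc (suc zero))))

  degreeSum-≤ : ∀ (w : Vector (Fin n) 4) {d₀ d₁ d₂ d₃} →
                degree G (w zero) ≤ d₀ → degree G (w (suc zero)) ≤ d₁ →
                degree G (w (suc (suc zero))) ≤ d₂ → degree G (w (suc (suc (suc zero)))) ≤ d₃ →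
                degreeSum w ≤ d₀ + d₁ + d₂ + d₃
  degreeSum-≤ _ h₀ h₁ h₂ h₃ = +-mono-≤ (+-mono-≤ (+-mono-≤ h₀ h₁) h₂) h₃

  high-degree-or-maxDegree≤ : ∀ k → (∃ λ x → suc k ≤ degree G x) ⊎ (∀ x → degree G x ≤ k)
  high-degree-or-maxDegree≤ k with any? (λ x → suc k ≤? degree G x)
  ... | yes high = inj₁ high
  ... | no ¬high = inj₂ λ x → ≤-pred (≰⇒> (¬high ∘ (x ,_)))

  K4WithDegreeSum≤ : ℕ → Set
  K4WithDegreeSum≤ m = Σ (Vector (Fin n) 4) λ w → IsClique G w × degreeSum w ≤ m

module _ (G : SimpleGraph 21) (noK5 : ¬ HasClique G 5) (noI5 : ¬ HasIndependentSet G 5)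
         (Δ≤7 : ∀ x → degree G x ≤ 7) where

  ∣N∣≤7 : ∀ x → ∣ N? G x ∣ ≤ 7
  ∣N∣≤7 x = subst (_≤ 7) (degree≡∣N∣ G x) (Δ≤7 x)

  module LowDegreePair (u v : Fin 21) (u≁v : Nonadjacent G u v)
                       (du : degree G u ≤ 4) (dv : degree G v ≤ 4) where

    ∣N[v]∣≤4 : ∣ N? G v ∣ ≤ 4
    ∣N[v]∣≤4 = subst (_≤ 4) (degree≡∣N∣ G v) dv

    A : Pred (Fin 21) 0ℓ
    A = Adj G u ∖ Adj G v

    A? : Decidable A
    A? = N? G u ∖? N? G v

    W : Pred (Fin 21) 0ℓ
    W = ∁ (Adj G v ∪ ｛ u ｝ ∪ ｛ v ｝ ∪ Adj G u)

    W? : Decidable W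
    W? = ∁? (N? G v ∪? ｛ u ｝? ∪? ｛ v ｝? ∪? N? G u)

    W-nonadjacent-u : ∀ {x} → x ∈ W → Nonadjacent G x u
    W-nonadjacent-u x∈W = (λ x≡u → x∈W (inj₂ (inj₁ (sym x≡u))))
                        , (λ x~u → x∈W (inj₂ (inj₂ (inj₂ (adj-sym G x~u)))))

    W-nonadjacent-v : ∀ {x} → x ∈ W → Nonadjacent G x v
    W-nonadjacent-v x∈W = (λ x≡v → x∈W (inj₂ (inj₂ (inj₁ (sym x≡v)))))
                        , (λ x~v → x∈W (inj₁ (adj-sym G x~v)))

    adj-u⇒∉W : ∀ {x} → Adj G u x → x ∉ W
    adj-u⇒∉W u~x x∈W = x∈W (inj₂ (inj₂ (inj₂ u~x)))

    ∣A∣+∣W∣≥15 : 15 ≤ ∣ A? ∣ + ∣ W? ∣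
    ∣A∣+∣W∣≥15 = +-cancelˡ-≤ 6 15 _ $ begin
      21                  ≡⟨ sym (∣∣-∁ (N? G v ∪? ｛ u ｝? ∪? ｛ v ｝? ∪? N? G u)) ⟩
      _ + ∣ W? ∣          ≤⟨ +-monoˡ-≤ ∣ W? ∣ ∣∁W∣≤6+∣A∣ ⟩
      6 + ∣ A? ∣ + ∣ W? ∣ ∎
      where
      open ≤-Reasoning
      rest⊆ : (｛ u ｝ ∪ ｛ v ｝ ∪ Adj G u) ∖ Adj G v ⊆ ｛ u ｝ ∪ ｛ v ｝ ∪ A
      rest⊆ (inj₁ u≡x , _)         = inj₁ u≡x
      rest⊆ (inj₂ (inj₁ v≡x) , _)  = inj₂ (inj₁ v≡x)
      rest⊆ (inj₂ (inj₂ u~x) , v≁x) = inj₂ (inj₂ (u~x , v≁x))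
      ∣∁W∣≤6+∣A∣ : ∣ N? G v ∪? ｛ u ｝? ∪? ｛ v ｝? ∪? N? G u ∣ ≤ 6 + ∣ A? ∣
      ∣∁W∣≤6+∣A∣ = begin
        ∣ N? G v ∪? ｛ u ｝? ∪? ｛ v ｝? ∪? N? G u ∣
          ≤⟨ ∣∪∣≤∣∣+∣∖∣ ⟩
        ∣ N? G v ∣ + ∣ (｛ u ｝? ∪? ｛ v ｝? ∪? N? G u) ∖? N? G v ∣
          ≤⟨ +-mono-≤ ∣N[v]∣≤4 (∣∣-mono rest⊆) ⟩
        4 + ∣ ｛ u ｝? ∪? ｛ v ｝? ∪? A? ∣
          ≤⟨ +-monoʳ-≤ 4 ∣∪∣≤∣∣+∣∣ ⟩
        4 + (∣ ｛ u ｝? ∣ + ∣ ｛ v ｝? ∪? A? ∣)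
          ≤⟨ +-monoʳ-≤ 4 (+-mono-≤ (∣｛｝∣≤1 u) ∣∪∣≤∣∣+∣∣) ⟩
        5 + (∣ ｛ v ｝? ∣ + ∣ A? ∣)
          ≤⟨ +-monoʳ-≤ 5 (+-monoˡ-≤ ∣ A? ∣ (∣｛｝∣≤1 v)) ⟩
        6 + ∣ A? ∣
          ∎

    ∣W∣≥11 : 11 ≤ ∣ W? ∣
    ∣W∣≥11 = +-cancelˡ-≤ 4 11 _ (≤-trans ∣A∣+∣W∣≥15 (+-monoˡ-≤ ∣ W? ∣ ∣A∣≤4))
      where
      ∣A∣≤4 : ∣ A? ∣ ≤ 4
      ∣A∣≤4 = ≤-trans (∣∣-mono proj₁) (subst (_≤ 4) (degree≡∣N∣ G u) du)

    ∣W∣≤5+∣N∩W∣ : ∀ {x} → x ∈ W → ∣ W? ∣ ≤ 5 + ∣ N? G x ∩? W? ∣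
    ∣W∣≤5+∣N∩W∣ {x} x∈W = begin
      ∣ W? ∣                                       ≡⟨ ∣∣-split ⟩
      ∣ W? ∩? N[x]? ∣ + ∣ W? ∖? N[x]? ∣            ≡⟨ +-comm ∣ W? ∩? N[x]? ∣ _ ⟩
      ∣ W? ∖? N[x]? ∣ + ∣ W? ∩? N[x]? ∣            ≤⟨ +-mono-≤ ∣W∖N[x]∣≤4 (∣∣-mono W∩N[x]⊆) ⟩
      4 + ∣ ｛ x ｝? ∪? N? G x ∩? W? ∣              ≤⟨ +-monoʳ-≤ 4 ∣∪∣≤∣∣+∣∣ ⟩
      4 + (∣ ｛ x ｝? ∣ + ∣ N? G x ∩? W? ∣)         ≤⟨ +-monoʳ-≤ 4 (+-monoˡ-≤ _ (∣｛｝∣≤1 x)) ⟩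
      5 + ∣ N? G x ∩? W? ∣                          ∎
      where
      open ≤-Reasoning
      N[x]? = N? G x ∪? ｛ x ｝?
      W∩N[x]⊆ : W ∩ (Adj G x ∪ ｛ x ｝) ⊆ ｛ x ｝ ∪ Adj G x ∩ W
      W∩N[x]⊆ (y∈W , inj₁ x~y) = inj₂ (x~y , y∈W)
      W∩N[x]⊆ (_   , inj₂ x≡y) = inj₁ x≡y
      uvx-independent : IsIndependent G (u ∷ᵛ v ∷ᵛ x ∷ᵛ []ᵛ)
      uvx-independent = independent₃ G u≁v (nonadjacent-sym G (W-nonadjacent-u x∈W))
                                           (nonadjacent-sym G (W-nonadjacent-v x∈W))
      far : ∀ {y} → y ∈ W ∖ (Adj G x ∪ ｛ x ｝) → ∀ i → Nonadjacent G y ((u ∷ᵛ v ∷ᵛ x ∷ᵛ []ᵛ) i)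
      far (y∈W , _)      zero             = W-nonadjacent-u y∈W
      far (y∈W , _)      (suc zero)       = W-nonadjacent-v y∈W
      far (_   , y∉N[x]) (suc (suc zero)) = ∉N[x]⇒nonadjacent G y∉N[x]
      ∣W∖N[x]∣≤4 : ∣ W? ∖? N[x]? ∣ ≤ 4
      ∣W∖N[x]∣≤4 =
        ∣pairwiseAdjacent∣≤ G (commonNonNeighbours-pairwiseAdjacent G noI5 uvx-independent far) noK5

    ∣W∣+∣N∖W∣≤12 : ∀ {x} → x ∈ W → ∣ W? ∣ + ∣ N? G x ∖? W? ∣ ≤ 12
    ∣W∣+∣N∖W∣≤12 {x} x∈W = begin
      ∣ W? ∣ + ∣ N? G x ∖? W? ∣                     ≤⟨ +-monoˡ-≤ _ (∣W∣≤5+∣N∩W∣ x∈W) ⟩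
      5 + (∣ N? G x ∩? W? ∣ + ∣ N? G x ∖? W? ∣)     ≡⟨ cong (5 +_) (sym ∣∣-split) ⟩
      5 + ∣ N? G x ∣                                ≤⟨ +-monoʳ-≤ 5 (∣N∣≤7 x) ⟩
      12                                            ∎
      where open ≤-Reasoning

    ∣W∣≤12 : ∣ W? ∣ ≤ 12
    ∣W∣≤12 = let x , x∈W = ∣∣≥1⇒∈ (≤-trans (s≤s z≤n) ∣W∣≥11)
             in ≤-trans (m≤m+n _ _) (∣W∣+∣N∖W∣≤12 x∈W)

    ∣N∖W∣≤1 : ∀ {x} → x ∈ W → ∣ N? G x ∖? W? ∣ ≤ 1
    ∣N∖W∣≤1 x∈W = +-cancelˡ-≤ 11 _ 1 (≤-trans (+-monoˡ-≤ _ ∣W∣≥11) (∣W∣+∣N∖W∣≤12 x∈W))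

    W-vertex-misses-A-or-B : ∀ {x p q} → x ∈ W → p ∈ A → q ∈ Adj G v ∖ Adj G u →
                             Adj G x p → Adj G x q → ⊥
    W-vertex-misses-A-or-B {x} x∈W (u~p , _) (v~q , u≁q) x~p x~q =
      <-irrefl refl (≤-trans ∣N∖W∣≥2 (∣N∖W∣≤1 x∈W))
      where
      ∣N∖W∣≥2 : 2 ≤ ∣ N? G x ∖? W? ∣
      ∣N∖W∣≥2 = length≤∣∣ ((adj-≢ G u~p u≁q ∷ []) ∷ [] ∷ [])
                          ((x~p , adj-u⇒∉W u~p) ∷ (x~q , λ q∈W → q∈W (inj₁ v~q)) ∷ [])

    no-nonadjacent-pairs-on-both-sides :
      NonadjacentPairIn G A → NonadjacentPairIn G (Adj G v ∖ Adj G u) → ⊥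
    no-nonadjacent-pairs-on-both-sides (a₁ , a₂ , a₁∈A , a₂∈A , a₁≁a₂)
                                       (b₁ , b₂ , b₁∈B , b₂∈B , b₁≁b₂) =
      let x , x∈W , x∈NA , x∈NB = ∣∣≥1⇒∈ (≤-trans (s≤s z≤n) ∣X∣≥3)
          _ , p∈A , x~p = neighbour-of-pair G a₁∈A a₂∈A x∈NA
          _ , q∈B , x~q = neighbour-of-pair G b₁∈B b₂∈B x∈NB
      in W-vertex-misses-A-or-B x∈W p∈A q∈B x~p x~q
      where
      NA? = N? G a₁ ∪? N? G a₂
      NB? = N? G b₁ ∪? N? G b₂
      ∣W∖NA∣≤4 : ∣ W? ∖? NA? ∣ ≤ 4
      ∣W∖NA∣≤4 = ∣pairwiseAdjacent∣≤ G
        (nonNeighbours-of-pair-pairwiseAdjacent G noI5 (proj₂ u≁v) a₁∈A a₂∈A a₁≁a₂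
           λ s∈W → W-nonadjacent-u s∈W , W-nonadjacent-v s∈W)
        noK5
      ∣W∖NB∣≤4 : ∣ W? ∖? NB? ∣ ≤ 4
      ∣W∖NB∣≤4 = ∣pairwiseAdjacent∣≤ G
        (nonNeighbours-of-pair-pairwiseAdjacent G noI5 (proj₂ u≁v ∘ adj-sym G) b₁∈B b₂∈B b₁≁b₂
           λ s∈W → W-nonadjacent-v s∈W , W-nonadjacent-u s∈W)
        noK5
      ∣X∣≥3 : 3 ≤ ∣ W? ∩? NA? ∩? NB? ∣
      ∣X∣≥3 = +-cancelʳ-≤ 8 3 _ $ begin
        11
          ≤⟨ ∣W∣≥11 ⟩
        ∣ W? ∣
          ≡⟨ ∣∣-split ⟩
        ∣ W? ∩? NA? ∣ + ∣ W? ∖? NA? ∣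
          ≡⟨ cong (_+ ∣ W? ∖? NA? ∣) ∣∣-split ⟩
        ∣ (W? ∩? NA?) ∩? NB? ∣ + ∣ (W? ∩? NA?) ∖? NB? ∣ + ∣ W? ∖? NA? ∣
          ≤⟨ +-mono-≤ (+-mono-≤ (∣∣-mono λ ((w , a) , b) → w , a , b)
                                (≤-trans (∣∣-mono λ ((w , _) , ¬b) → w , ¬b) ∣W∖NB∣≤4))
                      ∣W∖NA∣≤4 ⟩
        ∣ W? ∩? NA? ∩? NB? ∣ + 4 + 4
          ≡⟨ +-assoc ∣ W? ∩? NA? ∩? NB? ∣ 4 4 ⟩
        ∣ W? ∩? NA? ∩? NB? ∣ + 8
          ∎
        where open ≤-Reasoning

    module _ (A-pairwiseAdjacent : PairwiseAdjacent G A) where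

      ∣A∣≤3 : ∣ A? ∣ ≤ 3
      ∣A∣≤3 = ∣pairwiseAdjacent-neighbours∣≤ G A-pairwiseAdjacent noK5 proj₁

      ∣A∣≥3 : 3 ≤ ∣ A? ∣
      ∣A∣≥3 = +-cancelʳ-≤ 12 3 _ (≤-trans ∣A∣+∣W∣≥15 (+-monoʳ-≤ ∣ A? ∣ ∣W∣≤12))

      ∣W∣≥12 : 12 ≤ ∣ W? ∣
      ∣W∣≥12 = +-cancelˡ-≤ 3 12 _ (≤-trans ∣A∣+∣W∣≥15 (+-monoˡ-≤ ∣ W? ∣ ∣A∣≤3))

      A-nonadjacent-W : ∀ {x y} → x ∈ W → y ∈ A → ¬ Adj G x y
      A-nonadjacent-W x∈W (u~y , _) x~y = <-irrefl refl $ begin-strict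
        12 + 0                   <⟨ +-monoʳ-≤ 12 (∈⇒∣∣≥1 (x~y , adj-u⇒∉W u~y)) ⟩
        12 + ∣ N? G _ ∖? W? ∣     ≤⟨ +-monoˡ-≤ _ ∣W∣≥12 ⟩
        ∣ W? ∣ + ∣ N? G _ ∖? W? ∣ ≤⟨ ∣W∣+∣N∖W∣≤12 x∈W ⟩
        12                       ∎
        where open ≤-Reasoning

      ∣∁W∣≤9 : ∣ ∁? W? ∣ ≤ 9
      ∣∁W∣≤9 = +-cancelˡ-≤ 12 _ 9 (≤-trans (+-monoˡ-≤ _ ∣W∣≥12) (≤-reflexive (∣∣-∁ W?)))

      A-degree≤6 : ∀ {y c} → y ∈ A → c ∈ Adj G u ∩ Adj G v → ¬ Adj G c y → degree G y ≤ 6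
      A-degree≤6 {y} {c} y∈A@(u~y , v≁y) (u~c , v~c) c≁y = +-cancelʳ-≤ 3 _ 6 $ begin
        degree G y + 3                       ≡⟨ cong (_+ 3) (degree≡∣N∣ G y) ⟩
        ∣ N? G y ∣ + 3                        ≤⟨ +-mono-≤ (∣∣-mono N[y]⊆∁W) vcy∈∁W∖N[y] ⟩
        ∣ ∁? W? ∩? N? G y ∣ + ∣ ∁? W? ∖? N? G y ∣ ≡⟨ sym ∣∣-split ⟩
        ∣ ∁? W? ∣                             ≤⟨ ∣∁W∣≤9 ⟩
        9                                    ∎
        where
        open ≤-Reasoning
        N[y]⊆∁W : Adj G y ⊆ ∁ W ∩ Adj G y
        N[y]⊆∁W y~z = (λ z∈W → A-nonadjacent-W z∈W y∈A (adj-sym G y~z)) , y~z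
        vcy∈∁W∖N[y] : 3 ≤ ∣ ∁? W? ∖? N? G y ∣
        vcy∈∁W∖N[y] =
          length≤∣∣ ((adj⇒≢ G v~c ∷ ≢-sym (adj-≢ G u~y (proj₂ u≁v)) ∷ [])
                    ∷ (adj-≢ G v~c v≁y ∷ [])
                    ∷ []
                    ∷ [])
                    (((λ v∈W → proj₁ (W-nonadjacent-v v∈W) refl) , v≁y ∘ adj-sym G)
                    ∷ (adj-u⇒∉W u~c , c≁y ∘ adj-sym G)
                    ∷ (adj-u⇒∉W u~y , λ y~y → adj⇒≢ G y~y refl)
                    ∷ [])

      lightK4 : K4WithDegreeSum≤ G 24
      lightK4 = u ∷ᵛ a , ua-clique , degreeSum≤24 (1 ≤? ∣ N? G u ∩? N? G v ∣)
        where
        A-triangle = pairwiseAdjacent⇒clique G A-pairwiseAdjacent ∣A∣≥3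
        a = proj₁ A-triangle
        a∈A = proj₂ (proj₂ A-triangle)
        a₀ = a zero
        a₁ = a (suc zero)
        a₂ = a (suc (suc zero))
        ua-clique : IsClique G (u ∷ᵛ a)
        ua-clique = clique-∷ G (proj₁ (proj₂ A-triangle)) (proj₁ ∘ a∈A)
        degree-u≤3 : ¬ 1 ≤ ∣ N? G u ∩? N? G v ∣ → degree G u ≤ 3
        degree-u≤3 N[u]∩N[v]≡∅ = begin
          degree G u                               ≡⟨ degree≡∣N∣ G u ⟩
          ∣ N? G u ∣                               ≡⟨ ∣∣-split ⟩
          ∣ N? G u ∩? N? G v ∣ + ∣ A? ∣            ≤⟨ +-mono-≤ (≤-pred (≰⇒> N[u]∩N[v]≡∅)) ∣A∣≤3 ⟩
          3                                        ∎
          where open ≤-Reasoning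
        degreeSum≤24-if-low : ∀ i → degree G (a i) ≤ 6 → degreeSum G (u ∷ᵛ a) ≤ 24
        degreeSum≤24-if-low zero             a₀≤6 = degreeSum-≤ G (u ∷ᵛ a) du a₀≤6 (Δ≤7 a₁) (Δ≤7 a₂)
        degreeSum≤24-if-low (suc zero)       a₁≤6 = degreeSum-≤ G (u ∷ᵛ a) du (Δ≤7 a₀) a₁≤6 (Δ≤7 a₂)
        degreeSum≤24-if-low (suc (suc zero)) a₂≤6 = degreeSum-≤ G (u ∷ᵛ a) du (Δ≤7 a₀) (Δ≤7 a₁) a₂≤6
        degreeSum≤24-if-common : ∀ {c} → c ∈ Adj G u ∩ Adj G v → Dec (∀ i → Adj G c (a i)) →
                           degreeSum G (u ∷ᵛ a) ≤ 24
        degreeSum≤24-if-common {c} (u~c , _) (yes c~a) =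
          ⊥-elim (noK5 (c ∷ᵛ u ∷ᵛ a ,
                        clique-∷ G ua-clique λ { zero → adj-sym G u~c ; (suc i) → c~a i }))
        degreeSum≤24-if-common {c} c∈N[u]∩N[v] (no ¬c~a) =
          let i , c≁aᵢ = ¬∀⟶∃¬ 3 _ (λ i → N? G c (a i)) ¬c~a
          in degreeSum≤24-if-low i (A-degree≤6 (a∈A i) c∈N[u]∩N[v] c≁aᵢ)
        degreeSum≤24 : Dec (1 ≤ ∣ N? G u ∩? N? G v ∣) → degreeSum G (u ∷ᵛ a) ≤ 24
        degreeSum≤24 (no N[u]∩N[v]≡∅) = degreeSum-≤ G (u ∷ᵛ a) (degree-u≤3 N[u]∩N[v]≡∅)
                                          (Δ≤7 a₀) (Δ≤7 a₁) (Δ≤7 a₂)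
        degreeSum≤24 (yes N[u]∩N[v]≢∅) =
          let c , c∈N[u]∩N[v] = ∣∣≥1⇒∈ N[u]∩N[v]≢∅
          in degreeSum≤24-if-common c∈N[u]∩N[v] (all? (λ i → N? G c (a i)))

  lightK4 : ∀ {u v} → Nonadjacent G u v → degree G u ≤ 4 → degree G v ≤ 4 → K4WithDegreeSum≤ G 24
  lightK4 {u} {v} u≁v du dv =
    [ LowDegreePair.lightK4 u v u≁v du dv
    , (λ A-pair → [ LowDegreePair.lightK4 v u (nonadjacent-sym G u≁v) dv du
                  , ⊥-elim ∘ LowDegreePair.no-nonadjacent-pairs-on-both-sides u v u≁v du dv A-pair
                  ]′ (pairwiseAdjacent-or-nonadjacentPair G (N? G v ∖? N? G u)))
    ]′ (pairwiseAdjacent-or-nonadjacentPair G (N? G u ∖? N? G v))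

lemma5p2 : (G : SimpleGraph 21) → IsRamsey 5 5 G →
    (∃[ u ] ∃[ v ] (u ≢ v × ¬ Adj G u v × degree G u ≤ 4 × degree G v ≤ 4)) →
    (∃[ x ] 8 ≤ degree G x)
    ⊎ (Σ (Fin 4 → Fin 21) λ w → (IsClique G w × degree G (w zero) + degree G (w (suc zero)) + degree G (w (suc (suc zero))) + degree G (w (suc (suc (suc zero)))) ≤ 24))
lemma5p2 G (noK5 , noI5) (u , v , u≢v , u≁v , du , dv) =
  map₂ (λ Δ≤7 → lightK4 G noK5 noI5 Δ≤7 (u≢v , u≁v) du dv) (high-degree-or-maxDegree≤ G 7)
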